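{- For every $\pi\in G_{r,n}$ and every integer $j\ge0$, \[ \Omega_{P(\pi)}(j)=\binom{rj+n-\mathrm{intdes}(\pi)}{n}. \]
   Context: Fix integers $r\ge1$, $n\ge1$. For a totally ordered set $Y$, $Y_{(r)}=\{0,\dots,r-1\}\times Y$ with the lexicographic order; write $x_k$ for $(k,x)$, $Y_k=\{k\}\times Y$, $|x_k|=x$, $\epsilon(x_k)=k$; color subscripts are read modulo $r$; $[n]=\{1,\dots,n\}$, $[0,n]=\{0,\dots,n\}$. $G_{r,n}$ is the group of bijections $\pi$ of $[n]_{(r)}$ with $\pi(i_j)=k_l\Rightarrow\pi(i_{j+a})=k_{l+a}$ (mod $r$), written in one-line notation $\pi(1)\cdots\pi(n)$, $\pi(i)=\pi(i_0)$. $\mathrm{Des}(\pi)=\{i\in[n]:\pi(i)>\pi(i+1)\}$ (order of $[0,n]_{(r)}$, with $\pi(n+1)=0_1$), $\mathrm{intdes}(\pi)=|\mathrm{Des}(\pi)\cap[n-1]|$. An $r$-colored poset is a finite set $P=\{0_1,\dots,0_{r-1}\}\cup Q$, $Q\subseteq[n]_{(r)}$ with distinct absolute values, with partial order $\prec$ such that $0_1\prec\cdots\prec0_{r-1}$. With $X=[0,j]$, a colored $P$-partition is a map $f:P\to X_{(r)}$ with (i) $f(0_k)=(k,0)$; (ii) $a\prec b\Rightarrow f(a)\le f(b)$; (iii) if $a\prec b$, $f(a),f(b)\in X_k$ for the same $k$, and $|a|_{\epsilon(a)-k}>|b|_{\epsilon(b)-k}$ in $[0,n]_{(r)}$, then $f(a)<f(b)$;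 (iv) if $f(a)=(k,j)$ then $\epsilon(a)=k$. $\Omega_P(j)$ is the number of such $f$. $P(\pi)$ is the disjoint union of the chains $0_1\prec\cdots\prec0_{r-1}$ and $\pi(1)\prec\cdots\prec\pi(n)$. -}

module Defs where

open import Data.Nat using (ℕ; zero; suc; _+_; _*_; _∸_; _≤_; _<_; _≤ᵇ_)
open import Data.Nat.Properties using (_≟_; _<?_; _≤?_)
open import Data.Bool using (Bool; true; false; if_then_else_)
open import Data.Product using (_×_; _,_; proj₁; proj₂)
open import Data.Product.Properties using (≡-dec)
open import Data.Sum using (_⊎_; inj₁; inj₂)
open import Data.Fin using (Fin; toℕ; splitAt)
import Data.Fin as F
open import Data.Fin.Properties using (all?)
open import Data.List using (List; []; _∷_; [_]; map; concatMap; filter; length; upTo; tabulate)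
open import Data.Empty using (⊥)
open import Relation.Binary.PropositionalEquality using (_≡_)
open import Relation.Nullary using (Dec; yes; no; does)
open import Relation.Nullary.Decidable using (_×-dec_; _→-dec_; _⊎-dec_)

-- Colored integers.  An element x_k of Y_(r) is encoded as the pair
-- (k , x) : ℕ × ℕ  (color first, absolute value second).

Col : Set
Col = ℕ × ℕ

ε : Col → ℕ
ε = proj₁

∣_∣c : Col → ℕ
∣ a ∣c = proj₂ a

_<ℓ_ : Col → Col → Set
(k , x) <ℓ (l , y) = (k < l) ⊎ ((k ≡ l) × (x < y))

_≤ℓ_ : Col → Col → Set
a ≤ℓ b = (a <ℓ b) ⊎ (a ≡ b)

_<ℓ?_ : (a b : Col) → Dec (a <ℓ b)
(k , x) <ℓ? (l , y) = (k <? l) ⊎-dec ((k ≟ l) ×-dec (x <? y))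

_≡c?_ : (a b : Col) → Dec (a ≡ b)
_≡c?_ = ≡-dec _≟_ _≟_

_≤ℓ?_ : (a b : Col) → Dec (a ≤ℓ b)
a ≤ℓ? b = (a <ℓ? b) ⊎-dec (a ≡c? b)

-- (c - k) mod r, for colors c , k ∈ {0,…,r-1}
subMod : (r c k : ℕ) → ℕ
subMod r c k = if k ≤ᵇ c then c ∸ k else (c + r) ∸ k

recolor : (r : ℕ) → Col → ℕ → Col
recolor r a k = (subMod r (ε a) k , ∣ a ∣c)

-- Colored permutations in one-line notation π(1)⋯π(n):
-- π i is the colored letter π(i+1) (positions are 0-based Fin n).
-- Colors lie in {0..r-1}, absolute values in [n], absolute values distinct.

IsColoredPerm : (r n : ℕ) → (Fin n → Col) → Set
IsColoredPerm r n π =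
  (∀ i → ε (π i) < r) ×
  (∀ i → (1 ≤ ∣ π i ∣c) × (∣ π i ∣c ≤ n)) ×
  (∀ i i' → ∣ π i ∣c ≡ ∣ π i' ∣c → i ≡ i')

countDes : List Col → ℕ
countDes (x ∷ y ∷ ys) = (if does (y <ℓ? x) then 1 else 0) + countDes (y ∷ ys)
countDes _ = 0

intdes : ∀ {n} → (Fin n → Col) → ℕ
intdes π = countDes (tabulate π)

-- r-colored posets, with finite carrier Fin m.  Each element carries its
-- label in [0,n]_(r) (the elements 0_k are those with absolute value 0),
-- and a decidable (strict) order relation.

record CPoset : Set₁ where
  field
    size : ℕ
    lab  : Fin size → Col
    _≺_  : Fin size → Fin size → Set
    _≺?_ : (a b : Fin size) → Dec (a ≺ b)

module _ (r : ℕ) (P : CPoset) (j : ℕ) where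
  open CPoset P

  -- colored P-partition f : P → X_(r), X = [0,j]
  -- (the codomain restriction is imposed by the enumeration in Ω below)
  IsPPartition : (Fin size → Col) → Set
  IsPPartition f =
    (∀ a → ∣ lab a ∣c ≡ 0 → f a ≡ lab a) ×
    (∀ a b → a ≺ b → f a ≤ℓ f b) ×
    (∀ a b → a ≺ b → ε (f a) ≡ ε (f b) →
        recolor r (lab b) (ε (f a)) <ℓ recolor r (lab a) (ε (f a)) →
        f a <ℓ f b) ×
    (∀ a → ∣ f a ∣c ≡ j → ε (lab a) ≡ ε (f a))

  isPPartition? : (f : Fin size → Col) → Dec (IsPPartition f)
  isPPartition? f =
    all? (λ a → (∣ lab a ∣c ≟ 0) →-dec (f a ≡c? lab a)) ×-dec
    all? (λ a → all? (λ b → (a ≺? b) →-dec (f a ≤ℓ? f b))) ×-dec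
    all? (λ a → all? (λ b → (a ≺? b) →-dec ((ε (f a) ≟ ε (f b)) →-dec
        ((recolor r (lab b) (ε (f a)) <ℓ? recolor r (lab a) (ε (f a))) →-dec
         (f a <ℓ? f b))))) ×-dec
    all? (λ a → (∣ f a ∣c ≟ j) →-dec (ε (lab a) ≟ ε (f a)))

-- the elements of X_(r), X = [0,j], listed without repetition
Xr : (r j : ℕ) → List Col
Xr r j = concatMap (λ k → map (λ x → (k , x)) (upTo (suc j))) (upTo r)

-- all functions Fin m → A with values in the given list (no repetitions
-- if the list has none)
consF : ∀ {A : Set} {m} → A → (Fin m → A) → Fin (suc m) → A
consF a g F.zero    = a
consF a g (F.suc i) = g i

allFuns : ∀ {A : Set} → List A → (m : ℕ) → List (Fin m → A)
allFuns xs zero    = [ (λ ()) ]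
allFuns xs (suc m) = concatMap (λ a → map (consF a) (allFuns xs m)) xs

Ω : (r : ℕ) → CPoset → (j : ℕ) → ℕ
Ω r P j = length (filter (isPPartition? r P j) (allFuns (Xr r j) (CPoset.size P)))

-- P(π): disjoint union of the chains 0_1 ≺ ⋯ ≺ 0_{r-1} and
-- π(1) ≺ ⋯ ≺ π(n).  Carrier Fin ((r ∸ 1) + n): the first r-1 elements
-- are 0_1,…,0_{r-1}, the remaining n are π(1),…,π(n).

chainLt : ∀ {p q} → (Fin p ⊎ Fin q) → (Fin p ⊎ Fin q) → Set
chainLt (inj₁ a) (inj₁ b) = toℕ a < toℕ b
chainLt (inj₂ a) (inj₂ b) = toℕ a < toℕ b
chainLt _ _ = ⊥

chainLt? : ∀ {p q} → (x y : Fin p ⊎ Fin q) → Dec (chainLt x y)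
chainLt? (inj₁ a) (inj₁ b) = toℕ a <? toℕ b
chainLt? (inj₂ a) (inj₂ b) = toℕ a <? toℕ b
chainLt? (inj₁ a) (inj₂ b) = no (λ ())
chainLt? (inj₂ a) (inj₁ b) = no (λ ())

Pπ : (r n : ℕ) → (Fin n → Col) → CPoset
Pπ r n π = record
  { size = (r ∸ 1) + n
  ; lab  = λ x → labS (splitAt (r ∸ 1) x)
  ; _≺_  = λ x y → chainLt (splitAt (r ∸ 1) x) (splitAt (r ∸ 1) y)
  ; _≺?_ = λ x y → chainLt? (splitAt (r ∸ 1) x) (splitAt (r ∸ 1) y)
  }
  where
    labS : Fin (r ∸ 1) ⊎ Fin n → Col
    labS (inj₁ a) = (suc (toℕ a) , 0)
    labS (inj₂ i) = π i

module Submission where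

-- Condition (i) fixes a P(π)-partition on the chain of zeros, so only its values on the
-- chain π(1) ≺ ⋯ ≺ π(n) vary.  For a letter of colour c, the values (k , x) ∈ [0,j]_(r)
-- allowed by (iv) are ranked bijectively onto {0,…,rj}, and (ii)+(iii) between consecutive
-- letters π(i) ≺ π(i+1) become  rank f(π(i)) + [π(i) > π(i+1)] ≤ rank f(π(i+1)):  the
-- recolouring in (iii) exactly compensates the colour shift in the rank.  So Ω counts the
-- sequences 0 ≤ u₁ ≤ ⋯ ≤ uₙ ≤ rj rising strictly at the descents of π, which the
-- hockey-stick identity, applied once per letter, counts as C(rj + n − intdes π, n).

open import Defs
open import Data.Nat using (ℕ; zero; suc; _+_; _*_; _∸_; _≤_; _<_; z≤n; s≤s; s≤s⁻¹; z<s; s<s; _≤ᵇ_)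
open import Data.Nat.Properties
open import Data.Nat.Combinatorics using (_C_; nCk+nC[k+1]≡[n+1]C[k+1]; k>n⇒nCk≡0)
open import Data.Nat.ListAction using (sum)
open import Data.Nat.ListAction.Properties using (sum-++)
open import Data.Nat.Tactic.RingSolver using (solve-∀)
open import Data.Bool using (true; false; if_then_else_; T)
open import Data.Unit using (tt)
open import Data.List using (List; []; _∷_; _++_; map; concatMap; filter; length; applyUpTo; upTo)
open import Data.List.Properties using (map-++; map-∘)
open import Data.List.Relation.Unary.All as All using (All; []; _∷_)
open import Data.List.Relation.Unary.All.Properties using (map⁺; concat⁺; applyUpTo⁺₁)
open import Data.Product using (_×_; _,_; proj₁; proj₂)
open import Data.Product.Relation.Binary.Lex.Strict using (×-transitive)
open import Data.Sum using (_⊎_; inj₁; inj₂)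
open import Data.Fin as F using (Fin; toℕ; splitAt; _↑ˡ_; _↑ʳ_)
open import Data.Fin.Properties using (all?; splitAt-↑ˡ; splitAt-↑ʳ; splitAt⁻¹-↑ˡ; splitAt⁻¹-↑ʳ)
open import Data.Empty using (⊥; ⊥-elim)
open import Function using (_∘_; id; _⇔_; mk⇔; Equivalence)
open import Function.Construct.Composition using (_⇔-∘_)
open import Relation.Binary.Definitions using (Transitive; tri<; tri≈; tri>)
open import Relation.Binary.PropositionalEquality
open import Relation.Nullary using (Dec; yes; no; does; ¬_)
open import Relation.Nullary.Decidable using (_×-dec_; _→-dec_)
import Relation.Binary.Construct.StrictToNonStrict _≡_ _<ℓ_ as ≤ℓ

-- Indicators and finite sums

𝟙 : ∀ {p} {P : Set p} → Dec P → ℕ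
𝟙 d = if does d then 1 else 0

𝟙-yes : ∀ {P : Set} (d : Dec P) → P → 𝟙 d ≡ 1
𝟙-yes (yes _) _ = refl
𝟙-yes (no ¬p) p = ⊥-elim (¬p p)

𝟙-no : ∀ {P : Set} (d : Dec P) → ¬ P → 𝟙 d ≡ 0
𝟙-no (yes p) ¬p = ⊥-elim (¬p p)
𝟙-no (no _) _ = refl

𝟙≤1 : ∀ {P : Set} (d : Dec P) → 𝟙 d ≤ 1
𝟙≤1 (yes _) = s≤s z≤n
𝟙≤1 (no _) = z≤n

𝟙-⇔ : ∀ {P Q : Set} (d : Dec P) (e : Dec Q) → P ⇔ Q → 𝟙 d ≡ 𝟙 e
𝟙-⇔ (yes p) e P⇔Q = sym (𝟙-yes e (Equivalence.to P⇔Q p))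
𝟙-⇔ (no ¬p) e P⇔Q = sym (𝟙-no e (¬p ∘ Equivalence.from P⇔Q))

𝟙-× : ∀ {P Q : Set} (d : Dec P) (e : Dec Q) → 𝟙 (d ×-dec e) ≡ 𝟙 d * 𝟙 e
𝟙-× (yes _) (yes _) = refl
𝟙-× (yes _) (no _) = refl
𝟙-× (no _) _ = refl

𝟙-*-congˡ : ∀ {P : Set} (d : Dec P) {x y : ℕ} → (P → x ≡ y) → 𝟙 d * x ≡ 𝟙 d * y
𝟙-*-congˡ (yes p) x≡y = cong (1 *_) (x≡y p)
𝟙-*-congˡ (no _) _ = refl

𝟙-*-congʳ : ∀ {P : Set} (d : Dec P) {x y : ℕ} → (P → x ≡ y) → x * 𝟙 d ≡ y * 𝟙 d
𝟙-*-congʳ d {x} {y} x≡y = trans (*-comm x (𝟙 d)) (trans (𝟙-*-congˡ d x≡y) (*-comm (𝟙 d) y))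

+𝟙≤ : ∀ {P : Set} (d : Dec P) {m n : ℕ} → (P → m < n) → (¬ P → m ≤ n) → m + 𝟙 d ≤ n
+𝟙≤ (yes p) {m} {n} m<n _ = subst (_≤ n) (+-comm 1 m) (m<n p)
+𝟙≤ (no ¬p) {m} {n} _ m≤n = subst (_≤ n) (sym (+-identityʳ m)) (m≤n ¬p)

<+𝟙 : ∀ {P : Set} (d : Dec P) {m n : ℕ} → (P → n ≤ m) → (¬ P → n < m) → n < m + 𝟙 d
<+𝟙 (yes p) {m} {n} n≤m _ = subst (n <_) (+-comm 1 m) (s≤s (n≤m p))
<+𝟙 (no ¬p) {m} {n} _ n<m = subst (n <_) (sym (+-identityʳ m)) (n<m ¬p)

∑ : ∀ {A : Set} → List A → (A → ℕ) → ℕ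
∑ xs w = sum (map w xs)

length-filter≡∑𝟙 : ∀ {A : Set} {P : A → Set} (P? : ∀ x → Dec (P x)) (xs : List A) →
  length (filter P? xs) ≡ ∑ xs (λ x → 𝟙 (P? x))
length-filter≡∑𝟙 P? [] = refl
length-filter≡∑𝟙 P? (x ∷ xs) with P? x
... | yes _ = cong suc (length-filter≡∑𝟙 P? xs)
... | no _ = length-filter≡∑𝟙 P? xs

∑-concatMap : ∀ {A B : Set} (F : A → List B) (xs : List A) (w : B → ℕ) →
  ∑ (concatMap F xs) w ≡ ∑ xs (λ a → ∑ (F a) w)
∑-concatMap F [] w = refl
∑-concatMap F (x ∷ xs) w = begin
  sum (map w (F x ++ concatMap F xs))          ≡⟨ cong sum (map-++ w (F x) _) ⟩
  sum (map w (F x) ++ map w (concatMap F xs))  ≡⟨ sum-++ (map w (F x)) _ ⟩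
  ∑ (F x) w + ∑ (concatMap F xs) w             ≡⟨ cong (∑ (F x) w +_) (∑-concatMap F xs w) ⟩
  ∑ (F x) w + ∑ xs (λ a → ∑ (F a) w)           ∎
  where open ≡-Reasoning

∑-map : ∀ {A B : Set} (g : A → B) (xs : List A) (w : B → ℕ) → ∑ (map g xs) w ≡ ∑ xs (w ∘ g)
∑-map g xs w = cong sum (sym (map-∘ xs))

∑-cong : ∀ {A : Set} {xs : List A} {v w : A → ℕ} → All (λ x → v x ≡ w x) xs → ∑ xs v ≡ ∑ xs w
∑-cong [] = refl
∑-cong (e ∷ es) = cong₂ _+_ e (∑-cong es)

∑-*ˡ : ∀ {A : Set} (c : ℕ) (xs : List A) (w : A → ℕ) → ∑ xs (λ x → c * w x) ≡ c * ∑ xs w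
∑-*ˡ c [] w = sym (*-zeroʳ c)
∑-*ˡ c (x ∷ xs) w = trans (cong (c * w x +_) (∑-*ˡ c xs w)) (sym (*-distribˡ-+ c (w x) _))

∑< : ℕ → (ℕ → ℕ) → ℕ
∑< zero f = 0
∑< (suc N) f = f 0 + ∑< N (f ∘ suc)

∑<-cong : ∀ N {f g : ℕ → ℕ} → (∀ u → u < N → f u ≡ g u) → ∑< N f ≡ ∑< N g
∑<-cong zero e = refl
∑<-cong (suc N) e = cong₂ _+_ (e 0 z<s) (∑<-cong N (λ u u<N → e (suc u) (s<s u<N)))

∑<-0 : ∀ N → ∑< N (λ _ → 0) ≡ 0
∑<-0 zero = refl
∑<-0 (suc N) = ∑<-0 N

∑<-+ : ∀ a b f → ∑< (a + b) f ≡ ∑< a f + ∑< b (λ u → f (a + u))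
∑<-+ zero b f = refl
∑<-+ (suc a) b f = trans (cong (f 0 +_) (∑<-+ a b (f ∘ suc))) (sym (+-assoc (f 0) _ _))

∑<-snoc : ∀ N f → ∑< (suc N) f ≡ ∑< N f + f N
∑<-snoc zero f = +-identityʳ (f 0)
∑<-snoc (suc N) f = trans (cong (f 0 +_) (∑<-snoc N (f ∘ suc))) (sym (+-assoc (f 0) _ _))

∑<-δ : ∀ N s K → s < N → ∑< N (λ k → 𝟙 (k ≟ s) * K) ≡ K
∑<-δ (suc N) zero K _ = trans (cong₂ _+_ (+-identityʳ K) (∑<-0 N)) (+-identityʳ K)
∑<-δ (suc N) (suc s) K (s<s s<N) = ∑<-δ N s K s<N

∑-applyUpTo : ∀ {A : Set} (g : ℕ → A) N (w : A → ℕ) → ∑ (applyUpTo g N) w ≡ ∑< N (w ∘ g)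
∑-applyUpTo g zero w = refl
∑-applyUpTo g (suc N) w = cong (w (g 0) +_) (∑-applyUpTo (g ∘ suc) N w)

∑<-blocks : (s w : ℕ → ℕ) → s 0 ≡ 0 → (∀ k → s (suc k) ≡ s k + w k) →
  ∀ r {F : ℕ → ℕ} → ∑< r (λ k → ∑< (w k) (λ x → F (s k + x))) ≡ ∑< (s r) F
∑<-blocks s w s0≡0 step zero {F} = cong (λ z → ∑< z F) (sym s0≡0)
∑<-blocks s w s0≡0 step (suc r) {F} = begin
  ∑< (suc r) G                                ≡⟨ ∑<-snoc r G ⟩
  ∑< r G + G r                                ≡⟨ cong (_+ G r) (∑<-blocks s w s0≡0 step r) ⟩
  ∑< (s r) F + ∑< (w r) (λ x → F (s r + x))  ≡⟨ ∑<-+ (s r) (w r) F ⟨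
  ∑< (s r + w r) F                            ≡⟨ cong (λ z → ∑< z F) (step r) ⟨
  ∑< (s (suc r)) F                            ∎
  where
  open ≡-Reasoning
  G : ℕ → ℕ
  G k = ∑< (w k) (λ x → F (s k + x))

hockey-stick : ∀ N t e k → e ≤ k → t ≤ N →
  ∑< N (λ u → 𝟙 (t ≤? u) * (((N ∸ suc u) + e) C k)) ≡ ((N ∸ t) + e) C suc k
hockey-stick zero .zero e k e≤k z≤n = sym (k>n⇒nCk≡0 (s≤s e≤k))
hockey-stick (suc N) zero e k e≤k t≤N = begin
  1 * ((N + e) C k) + ∑< N (λ u → 1 * (((N ∸ suc u) + e) C k))
    ≡⟨ cong (_+ ∑< N (λ u → 1 * (((N ∸ suc u) + e) C k))) (*-identityˡ _) ⟩
  (N + e) C k + ∑< N (λ u → 𝟙 (0 ≤? u) * (((N ∸ suc u) + e) C k))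
    ≡⟨ cong ((N + e) C k +_) (hockey-stick N 0 e k e≤k z≤n) ⟩
  (N + e) C k + (N + e) C suc k
    ≡⟨ nCk+nC[k+1]≡[n+1]C[k+1] (N + e) k ⟩
  (suc N + e) C suc k ∎
  where open ≡-Reasoning
hockey-stick (suc N) (suc t) e k e≤k (s≤s t≤N) =
  trans (∑<-cong N (λ u _ → cong (_* (((N ∸ suc u) + e) C k)) (𝟙-⇔ (suc t ≤? suc u) (t ≤? u) (mk⇔ s≤s⁻¹ s≤s))))
        (hockey-stick N t e k e≤k t≤N)

∑→ : ∀ {A : Set} → List A → (m : ℕ) → ((Fin m → A) → ℕ) → ℕ
∑→ xs m w = ∑ (allFuns xs m) w

∑→-suc : ∀ {A : Set} (xs : List A) m (w : (Fin (suc m) → A) → ℕ) →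
  ∑→ xs (suc m) w ≡ ∑ xs (λ a → ∑→ xs m (w ∘ consF a))
∑→-suc xs m w = trans (∑-concatMap _ xs w) (∑-cong (All.universal (λ a → ∑-map (consF a) (allFuns xs m) w) xs))

allFuns-valued : ∀ {A : Set} {G : A → Set} {xs : List A} → All G xs →
  ∀ m → All (λ f → ∀ i → G (f i)) (allFuns xs m)
allFuns-valued Gxs zero = (λ ()) ∷ []
allFuns-valued {A} {G} Gxs (suc m) =
  concat⁺ (map⁺ (All.map (λ Ga → map⁺ (All.map (consF-valued Ga) (allFuns-valued Gxs m))) Gxs))
  where
  consF-valued : ∀ {a} {g : Fin m → A} → G a → (∀ i → G (g i)) → ∀ i → G (consF a g i)
  consF-valued Ga Gg F.zero = Ga
  consF-valued Ga Gg (F.suc i) = Gg i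

∑→-cong : ∀ {A : Set} {G : A → Set} {xs : List A} → All G xs → ∀ m {v w : (Fin m → A) → ℕ} →
  (∀ f → (∀ i → G (f i)) → v f ≡ w f) → ∑→ xs m v ≡ ∑→ xs m w
∑→-cong Gxs m v≗w = ∑-cong (All.map (λ {f} → v≗w f) (allFuns-valued Gxs m))

-- The lexicographic order on colored integers

<ℓ-trans : Transitive _<ℓ_
<ℓ-trans = ×-transitive {_<₂_ = _<_} isEquivalence (resp₂ _<_) <-trans <-trans

<ℓ-irrefl : ∀ {a} → ¬ (a <ℓ a)
<ℓ-irrefl (inj₁ k<k) = <-irrefl refl k<k
<ℓ-irrefl (inj₂ (_ , x<x)) = <-irrefl refl x<x

≮ℓ⇒≥ : ∀ a b → ¬ (a <ℓ b) → b ≤ℓ a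
≮ℓ⇒≥ (k , x) (l , y) a≮b with <-cmp k l
... | tri< k<l _ _ = ⊥-elim (a≮b (inj₁ k<l))
... | tri> _ _ l<k = inj₁ (inj₁ l<k)
... | tri≈ _ refl _ with <-cmp x y
...   | tri< x<y _ _ = ⊥-elim (a≮b (inj₂ (refl , x<y)))
...   | tri≈ _ refl _ = inj₂ refl
...   | tri> _ _ y<x = inj₁ (inj₂ (refl , y<x))

≤ℓ-trans : Transitive _≤ℓ_
≤ℓ-trans = ≤ℓ.trans isEquivalence (resp₂ _<ℓ_) <ℓ-trans

≤ℓ-antisym : ∀ {a b} → a ≤ℓ b → b ≤ℓ a → a ≡ b
≤ℓ-antisym = ≤ℓ.antisym isEquivalence <ℓ-trans (λ { refl → <ℓ-irrefl })

≤<ℓ-trans : ∀ {a b c} → a ≤ℓ b → b <ℓ c → a <ℓ c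
≤<ℓ-trans = ≤ℓ.≤-<-trans sym <ℓ-trans (respˡ _<ℓ_)

≤ℓ⇒colour≤ : ∀ {a b} → a ≤ℓ b → ε a ≤ ε b
≤ℓ⇒colour≤ (inj₁ (inj₁ k<l)) = <⇒≤ k<l
≤ℓ⇒colour≤ (inj₁ (inj₂ (refl , _))) = ≤-refl
≤ℓ⇒colour≤ (inj₂ refl) = ≤-refl

<ℓ-sameColour⇔ : ∀ {k x y} → (k , x) <ℓ (k , y) ⇔ x < y
<ℓ-sameColour⇔ = mk⇔ (λ { (inj₁ k<k) → ⊥-elim (<-irrefl refl k<k) ; (inj₂ (_ , x<y)) → x<y })
                      (λ x<y → inj₂ (refl , x<y))

≤ℓ-sameColour⇔ : ∀ {k x y} → (k , x) ≤ℓ (k , y) ⇔ x ≤ y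
≤ℓ-sameColour⇔ = mk⇔ (λ { (inj₁ lt) → <⇒≤ (Equivalence.to <ℓ-sameColour⇔ lt) ; (inj₂ refl) → ≤-refl })
                      (λ x≤y → from≤ (m≤n⇒m<n∨m≡n x≤y))
  where
  from≤ : ∀ {k x y} → x < y ⊎ x ≡ y → (k , x) ≤ℓ (k , y)
  from≤ (inj₁ x<y) = inj₁ (inj₂ (refl , x<y))
  from≤ (inj₂ refl) = inj₂ refl

InRange : ℕ → ℕ → Col → Set
InRange r j y = ε y < r × ∣ y ∣c ≤ j

Xr-inRange : ∀ r j → All (InRange r j) (Xr r j)
Xr-inRange r j =
  concat⁺ (map⁺ (applyUpTo⁺₁ id r λ k<r → map⁺ (applyUpTo⁺₁ id (suc j) λ x<1+j → k<r , s≤s⁻¹ x<1+j)))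

∑-Xr : ∀ r j (w : Col → ℕ) → ∑ (Xr r j) w ≡ ∑< r (λ k → ∑< (suc j) (λ x → w (k , x)))
∑-Xr r j w = begin
  ∑ (Xr r j) w                                       ≡⟨ ∑-concatMap _ (upTo r) w ⟩
  ∑ (upTo r) (λ k → ∑ (map (k ,_) (upTo (suc j))) w) ≡⟨ ∑-applyUpTo id r _ ⟩
  ∑< r (λ k → ∑ (map (k ,_) (upTo (suc j))) w)
    ≡⟨ ∑<-cong r (λ k _ → trans (∑-map (k ,_) (upTo (suc j)) w) (∑-applyUpTo id (suc j) (λ x → w (k , x)))) ⟩
  ∑< r (λ k → ∑< (suc j) (λ x → w (k , x)))           ∎
  where open ≡-Reasoning

∑-Xr-δ : ∀ r j s K → s < r → ∑ (Xr r j) (λ y → 𝟙 (y ≡c? (s , 0)) * K) ≡ K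
∑-Xr-δ r j s K s<r = begin
  ∑ (Xr r j) (λ y → 𝟙 (y ≡c? (s , 0)) * K)
    ≡⟨ ∑-Xr r j _ ⟩
  ∑< r (λ k → ∑< (suc j) (λ x → 𝟙 ((k , x) ≡c? (s , 0)) * K))
    ≡⟨ ∑<-cong r (λ k _ → ∑<-cong (suc j) (λ x _ → split k x)) ⟩
  ∑< r (λ k → ∑< (suc j) (λ x → 𝟙 (x ≟ 0) * (𝟙 (k ≟ s) * K)))
    ≡⟨ ∑<-cong r (λ k _ → ∑<-δ (suc j) 0 _ z<s) ⟩
  ∑< r (λ k → 𝟙 (k ≟ s) * K)
    ≡⟨ ∑<-δ r s K s<r ⟩
  K ∎
  where
  open ≡-Reasoning
  split : ∀ k x → 𝟙 ((k , x) ≡c? (s , 0)) * K ≡ 𝟙 (x ≟ 0) * (𝟙 (k ≟ s) * K)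
  split k x = begin
    𝟙 ((k , x) ≡c? (s , 0)) * K
      ≡⟨ cong (_* K) (𝟙-⇔ ((k , x) ≡c? (s , 0)) (x ≟ 0 ×-dec k ≟ s) (mk⇔ (λ { refl → refl , refl }) (λ { (refl , refl) → refl }))) ⟩
    𝟙 (x ≟ 0 ×-dec k ≟ s) * K         ≡⟨ cong (_* K) (𝟙-× (x ≟ 0) (k ≟ s)) ⟩
    𝟙 (x ≟ 0) * 𝟙 (k ≟ s) * K         ≡⟨ *-assoc (𝟙 (x ≟ 0)) _ K ⟩
    𝟙 (x ≟ 0) * (𝟙 (k ≟ s) * K)       ∎

-- Ranking the admissible values

Admissible : ℕ → ℕ → Col → Set
Admissible j c y = ∣ y ∣c ≡ j → c ≡ ε y

admissible? : ∀ j c y → Dec (Admissible j c y)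
admissible? j c y = (∣ y ∣c ≟ j) →-dec (c ≟ ε y)

-- Block k of [0,j]_(r) holds j + 1 values admissible for colour c if k = c and j otherwise,
-- so block k starts at rank k j + [c < k].
blockStart : ℕ → ℕ → ℕ → ℕ
blockStart j c k = k * j + 𝟙 (c <? k)

rank : ℕ → ℕ → Col → ℕ
rank j c (k , x) = blockStart j c k + x

𝟙-<-suc : ∀ c k → 𝟙 (c <? suc k) ≡ 𝟙 (c <? k) + 𝟙 (k ≟ c)
𝟙-<-suc c k with <-cmp c k
... | tri< c<k _ _ = trans (𝟙-yes (c <? suc k) (m<n⇒m<1+n c<k))
                           (sym (cong₂ _+_ (𝟙-yes (c <? k) c<k) (𝟙-no (k ≟ c) (≢-sym (<⇒≢ c<k)))))
... | tri≈ _ refl _ = trans (𝟙-yes (c <? suc c) (n<1+n c))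
                           (sym (cong₂ _+_ (𝟙-no (c <? c) (<-irrefl refl)) (𝟙-yes (c ≟ c) refl)))
... | tri> _ _ k<c = trans (𝟙-no (c <? suc k) (<⇒≱ k<c ∘ s≤s⁻¹))
                           (sym (cong₂ _+_ (𝟙-no (c <? k) (<-asym k<c)) (𝟙-no (k ≟ c) (<⇒≢ k<c))))

blockStart-suc : ∀ j c k → blockStart j c (suc k) ≡ blockStart j c k + (j + 𝟙 (k ≟ c))
blockStart-suc j c k = begin
  j + k * j + 𝟙 (c <? suc k)                  ≡⟨ cong (j + k * j +_) (𝟙-<-suc c k) ⟩
  j + k * j + (𝟙 (c <? k) + 𝟙 (k ≟ c))        ≡⟨ shuffle j (k * j) (𝟙 (c <? k)) (𝟙 (k ≟ c)) ⟩
  k * j + 𝟙 (c <? k) + (j + 𝟙 (k ≟ c))        ∎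
  where
  open ≡-Reasoning
  shuffle : ∀ a b x y → a + b + (x + y) ≡ b + x + (a + y)
  shuffle = solve-∀

∑<-admissible : ∀ j c k (F : ℕ → ℕ) →
  ∑< (suc j) (λ x → 𝟙 (admissible? j c (k , x)) * F x) ≡ ∑< (j + 𝟙 (k ≟ c)) F
∑<-admissible j c k F with k ≟ c
... | yes refl = begin
  ∑< (suc j) (λ x → 𝟙 (admissible? j k (k , x)) * F x)
    ≡⟨ ∑<-cong (suc j) (λ x _ → cong (_* F x) (𝟙-yes (admissible? j k (k , x)) (λ _ → refl))) ⟩
  ∑< (suc j) (λ x → 1 * F x)  ≡⟨ ∑<-cong (suc j) (λ x _ → *-identityˡ (F x)) ⟩
  ∑< (suc j) F                ≡⟨ cong (λ z → ∑< z F) (+-comm 1 j) ⟩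
  ∑< (j + 1) F                ≡⟨ cong (λ b → ∑< (j + b) F) (𝟙-yes (k ≟ k) refl) ⟨
  ∑< (j + 𝟙 (k ≟ k)) F        ∎
  where open ≡-Reasoning
... | no k≢c = begin
  ∑< (suc j) (λ x → 𝟙 (admissible? j c (k , x)) * F x)
    ≡⟨ ∑<-snoc j _ ⟩
  ∑< j (λ x → 𝟙 (admissible? j c (k , x)) * F x) + 𝟙 (admissible? j c (k , j)) * F j
    ≡⟨ cong₂ _+_ (∑<-cong j (λ x x<j → cong (_* F x) (𝟙-yes (admissible? j c (k , x)) (λ x≡j → ⊥-elim (<⇒≢ x<j x≡j)))))
                 (cong (_* F j) (𝟙-no (admissible? j c (k , j)) (λ adm → k≢c (sym (adm refl))))) ⟩
  ∑< j (λ x → 1 * F x) + 0     ≡⟨ +-identityʳ _ ⟩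
  ∑< j (λ x → 1 * F x)         ≡⟨ ∑<-cong j (λ x _ → *-identityˡ (F x)) ⟩
  ∑< j F                       ≡⟨ cong (λ z → ∑< z F) (+-identityʳ j) ⟨
  ∑< (j + 0) F                 ≡⟨ cong (λ b → ∑< (j + b) F) (𝟙-no (k ≟ c) k≢c) ⟨
  ∑< (j + 𝟙 (k ≟ c)) F         ∎
  where open ≡-Reasoning

∑-rank : ∀ r j c (F : ℕ → ℕ) → c < r →
  ∑ (Xr r j) (λ y → 𝟙 (admissible? j c y) * F (rank j c y)) ≡ ∑< (r * j + 1) F
∑-rank r j c F c<r = begin
  ∑ (Xr r j) (λ y → 𝟙 (admissible? j c y) * F (rank j c y))
    ≡⟨ ∑-Xr r j _ ⟩
  ∑< r (λ k → ∑< (suc j) (λ x → 𝟙 (admissible? j c (k , x)) * F (blockStart j c k + x)))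
    ≡⟨ ∑<-cong r (λ k _ → ∑<-admissible j c k (λ x → F (blockStart j c k + x))) ⟩
  ∑< r (λ k → ∑< (j + 𝟙 (k ≟ c)) (λ x → F (blockStart j c k + x)))
    ≡⟨ ∑<-blocks (blockStart j c) (λ k → j + 𝟙 (k ≟ c)) refl (blockStart-suc j c) r ⟩
  ∑< (r * j + 𝟙 (c <? r)) F
    ≡⟨ cong (λ b → ∑< (r * j + b) F) (𝟙-yes (c <? r) c<r) ⟩
  ∑< (r * j + 1) F ∎
  where open ≡-Reasoning

-- Recolouring and consecutive letters

subMod-≥ : ∀ r c k → k ≤ c → subMod r c k ≡ c ∸ k
subMod-≥ r c k k≤c with k ≤ᵇ c in eq
... | true = refl
... | false = ⊥-elim (subst T eq (≤⇒≤ᵇ k≤c))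

subMod-< : ∀ r c k → c < k → subMod r c k ≡ (c + r) ∸ k
subMod-< r c k c<k with k ≤ᵇ c in eq
... | true = ⊥-elim (<⇒≱ c<k (≤ᵇ⇒≤ k c (subst T (sym eq) tt)))
... | false = refl

<ℓ-∸⇔ : ∀ {k u v x y} → k ≤ u → k ≤ v → (u ∸ k , x) <ℓ (v ∸ k , y) ⇔ (u , x) <ℓ (v , y)
<ℓ-∸⇔ {k} k≤u k≤v = mk⇔
  (λ { (inj₁ lt) → inj₁ (subst₂ _<_ (m∸n+n≡m k≤u) (m∸n+n≡m k≤v) (+-monoˡ-< k lt))
     ; (inj₂ (e , lt)) → inj₂ (∸-cancelʳ-≡ k≤u k≤v e , lt) })
  (λ { (inj₁ lt) → inj₁ (∸-monoˡ-< lt k≤u) ; (inj₂ (refl , lt)) → inj₂ (refl , lt) })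

<ℓ-+⇔ : ∀ {r u v x y} → (u + r , x) <ℓ (v + r , y) ⇔ (u , x) <ℓ (v , y)
<ℓ-+⇔ {r} {u} {v} = mk⇔
  (λ { (inj₁ lt) → inj₁ (+-cancelʳ-< r u v lt) ; (inj₂ (e , lt)) → inj₂ (+-cancelʳ-≡ r u v e , lt) })
  (λ { (inj₁ lt) → inj₁ (+-monoˡ-< r lt) ; (inj₂ (refl , lt)) → inj₂ (refl , lt) })

≮ℓ-colour : ∀ {u v x y} → v < u → ¬ ((u , x) <ℓ (v , y))
≮ℓ-colour v<u (inj₁ u<v) = <-asym u<v v<u
≮ℓ-colour v<u (inj₂ (refl , _)) = <-irrefl refl v<u

-- Recolouring by -k (mod r) moves the colours below k to the top, so the recoloured
-- comparison differs from the plain one exactly when one of c₀, c₁ is below k and the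
-- other is not.
recolor-descent : ∀ {r k c₀ c₁} p₀ p₁ → k < r → c₀ < r → c₁ < r →
  𝟙 (recolor r (c₁ , p₁) k <ℓ? recolor r (c₀ , p₀) k) + 𝟙 (c₁ <? k)
    ≡ 𝟙 (c₀ <? k) + 𝟙 ((c₁ , p₁) <ℓ? (c₀ , p₀))
recolor-descent {r} {k} {c₀} {c₁} p₀ p₁ k<r c₀<r c₁<r = go (c₀ <? k) (c₁ <? k)
  where
  R? = recolor r (c₁ , p₁) k <ℓ? recolor r (c₀ , p₀) k
  D? = (c₁ , p₁) <ℓ? (c₀ , p₀)
  R≡ : ∀ {u v} → subMod r c₁ k ≡ u → subMod r c₀ k ≡ v →
    (recolor r (c₁ , p₁) k <ℓ recolor r (c₀ , p₀) k) ≡ ((u , p₁) <ℓ (v , p₀))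
  R≡ refl refl = refl
  k≤+r : ∀ c → k ≤ c + r
  k≤+r c = ≤-trans (<⇒≤ k<r) (m≤n+m r c)
  go : (d₀ : Dec (c₀ < k)) (d₁ : Dec (c₁ < k)) → 𝟙 R? + 𝟙 d₁ ≡ 𝟙 d₀ + 𝟙 D?
  go (no c₀≮k) (no c₁≮k) = trans (+-identityʳ _) (𝟙-⇔ R? D?
    (subst (_⇔ ((c₁ , p₁) <ℓ (c₀ , p₀))) (sym (R≡ (subMod-≥ r c₁ k (≮⇒≥ c₁≮k)) (subMod-≥ r c₀ k (≮⇒≥ c₀≮k))))
      (<ℓ-∸⇔ (≮⇒≥ c₁≮k) (≮⇒≥ c₀≮k))))
  go (yes c₀<k) (yes c₁<k) = trans (+-comm _ 1) (cong suc (𝟙-⇔ R? D?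
    (subst (_⇔ ((c₁ , p₁) <ℓ (c₀ , p₀))) (sym (R≡ (subMod-< r c₁ k c₁<k) (subMod-< r c₀ k c₀<k)))
      (<ℓ-+⇔ {r} ⇔-∘ <ℓ-∸⇔ (k≤+r c₁) (k≤+r c₀)))))
  go (no c₀≮k) (yes c₁<k) =
    trans (cong (_+ 1) (𝟙-no R? ¬R)) (sym (𝟙-yes D? (inj₁ (<-≤-trans c₁<k (≮⇒≥ c₀≮k)))))
    where
    ¬R : ¬ (recolor r (c₁ , p₁) k <ℓ recolor r (c₀ , p₀) k)
    ¬R = subst ¬_ (sym (R≡ (subMod-< r c₁ k c₁<k) (subMod-≥ r c₀ k (≮⇒≥ c₀≮k))))
      (≮ℓ-colour (∸-monoˡ-< (<-≤-trans c₀<r (m≤n+m r c₁)) (≮⇒≥ c₀≮k)))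
  go (yes c₀<k) (no c₁≮k) =
    trans (+-identityʳ _) (trans (𝟙-yes R? R) (cong suc (sym (𝟙-no D? (≮ℓ-colour (<-≤-trans c₀<k (≮⇒≥ c₁≮k)))))))
    where
    R : recolor r (c₁ , p₁) k <ℓ recolor r (c₀ , p₀) k
    R = subst id (sym (R≡ (subMod-≥ r c₁ k (≮⇒≥ c₁≮k)) (subMod-< r c₀ k c₀<k)))
      (inj₁ (∸-monoˡ-< (<-≤-trans c₁<r (m≤n+m r c₀)) (≮⇒≥ c₁≮k)))

Link : ℕ → Col → Col → Col → Col → Set
Link r p q a b = a ≤ℓ b × (ε a ≡ ε b → recolor r q (ε a) <ℓ recolor r p (ε a) → a <ℓ b)

link? : ∀ r p q a b → Dec (Link r p q a b)
link? r p q a b =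
  (a ≤ℓ? b) ×-dec ((ε a ≟ ε b) →-dec ((recolor r q (ε a) <ℓ? recolor r p (ε a)) →-dec (a <ℓ? b)))

sameBlock-link⇔ : ∀ {r p q k x x'} →
  Link r p q (k , x) (k , x') ⇔ x + 𝟙 (recolor r q k <ℓ? recolor r p k) ≤ x'
sameBlock-link⇔ {r} {p} {q} {k} {x} {x'} = go (recolor r q k <ℓ? recolor r p k)
  where
  go : (d : Dec (recolor r q k <ℓ recolor r p k)) → Link r p q (k , x) (k , x') ⇔ x + 𝟙 d ≤ x'
  go (yes R) = mk⇔
    (λ (_ , strict) → subst (_≤ x') (+-comm 1 x) (Equivalence.to <ℓ-sameColour⇔ (strict refl R)))
    (λ x+1≤x' → let x<x' = subst (_≤ x') (+-comm x 1) x+1≤x' in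
      inj₁ (inj₂ (refl , x<x')) , λ _ _ → inj₂ (refl , x<x'))
  go (no ¬R) = mk⇔
    (λ (x≤x' , _) → subst (_≤ x') (sym (+-identityʳ x)) (Equivalence.to ≤ℓ-sameColour⇔ x≤x'))
    (λ x+0≤x' → Equivalence.from ≤ℓ-sameColour⇔ (subst (_≤ x') (+-identityʳ x) x+0≤x') ,
      λ _ R → ⊥-elim (¬R R))

admissible⇒< : ∀ {j c k x} → Admissible j c (k , x) → x ≤ j → c ≢ k → x < j
admissible⇒< adm x≤j c≢k = ≤∧≢⇒< x≤j (c≢k ∘ adm)

rank≥ : ∀ j c k x → k * j ≤ rank j c (k , x)
rank≥ j c k x = ≤-trans (m≤m+n (k * j) _) (m≤m+n _ x)

rank> : ∀ {j c k} x → c < k → k * j < rank j c (k , x)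
rank> {j} {c} {k} x c<k = begin-strict
  k * j                    <⟨ m<m+n (k * j) z<s ⟩
  k * j + 1                ≡⟨ cong (k * j +_) (𝟙-yes (c <? k) c<k) ⟨
  blockStart j c k         ≤⟨ m≤m+n _ x ⟩
  rank j c (k , x)         ∎
  where open ≤-Reasoning

rank≤ : ∀ {j c k x} → Admissible j c (k , x) → x ≤ j → rank j c (k , x) ≤ suc k * j
rank≤ {j} {c} {k} {x} adm x≤j = go (c <? k)
  where
  open ≤-Reasoning
  go : (d : Dec (c < k)) → k * j + 𝟙 d + x ≤ suc k * j
  go (yes c<k) = begin
    k * j + 1 + x  ≡⟨ +-assoc (k * j) 1 x ⟩
    k * j + suc x  ≤⟨ +-monoʳ-≤ (k * j) (admissible⇒< adm x≤j (<⇒≢ c<k)) ⟩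
    k * j + j      ≡⟨ +-comm (k * j) j ⟩
    suc k * j      ∎
  go (no _) = begin
    k * j + 0 + x  ≡⟨ cong (_+ x) (+-identityʳ (k * j)) ⟩
    k * j + x      ≤⟨ +-monoʳ-≤ (k * j) x≤j ⟩
    k * j + j      ≡⟨ +-comm (k * j) j ⟩
    suc k * j      ∎

rank< : ∀ {j c k x} → Admissible j c (k , x) → x ≤ j → k < c → rank j c (k , x) < suc k * j
rank< {j} {c} {k} {x} adm x≤j k<c = begin-strict
  k * j + 𝟙 (c <? k) + x  ≡⟨ cong (λ b → k * j + b + x) (𝟙-no (c <? k) (<-asym k<c)) ⟩
  k * j + 0 + x           ≡⟨ cong (_+ x) (+-identityʳ (k * j)) ⟩
  k * j + x               <⟨ +-monoʳ-< (k * j) (admissible⇒< adm x≤j (≢-sym (<⇒≢ k<c))) ⟩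
  k * j + j               ≡⟨ +-comm (k * j) j ⟩
  suc k * j               ∎
  where open ≤-Reasoning

rank-mono : ∀ {j c c' k k' x x'} → k < k' → Admissible j c (k , x) → x ≤ j →
  rank j c (k , x) ≤ rank j c' (k' , x')
rank-mono {j} {c} {c'} {k} {k'} {x} {x'} k<k' adm x≤j = begin
  rank j c (k , x)     ≤⟨ rank≤ adm x≤j ⟩
  suc k * j            ≤⟨ *-monoˡ-≤ j k<k' ⟩
  k' * j               ≤⟨ rank≥ j c' k' x' ⟩
  rank j c' (k' , x')  ∎
  where open ≤-Reasoning

rank-mono-strict : ∀ {j c c' k k' x x'} → k < k' → Admissible j c (k , x) → x ≤ j →
  c' < k' ⊎ k < c → rank j c (k , x) < rank j c' (k' , x')
rank-mono-strict {j} {c} {c'} {k} {k'} {x} {x'} k<k' adm x≤j (inj₁ c'<k') = begin-strict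
  rank j c (k , x)     ≤⟨ rank≤ adm x≤j ⟩
  suc k * j            ≤⟨ *-monoˡ-≤ j k<k' ⟩
  k' * j               <⟨ rank> x' c'<k' ⟩
  rank j c' (k' , x')  ∎
  where open ≤-Reasoning
rank-mono-strict {j} {c} {c'} {k} {k'} {x} {x'} k<k' adm x≤j (inj₂ k<c) = begin-strict
  rank j c (k , x)     <⟨ rank< adm x≤j k<c ⟩
  suc k * j            ≤⟨ *-monoˡ-≤ j k<k' ⟩
  k' * j               ≤⟨ rank≥ j c' k' x' ⟩
  rank j c' (k' , x')  ∎
  where open ≤-Reasoning

colour-split : ∀ {k k' c c'} → k < k' → c' ≤ c → c' < k' ⊎ k < c
colour-split {k' = k'} {c' = c'} k<k' c'≤c with c' <? k'
... | yes c'<k' = inj₁ c'<k'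
... | no c'≮k' = inj₂ (<-≤-trans k<k' (≤-trans (≮⇒≥ c'≮k') c'≤c))

link⇔rank : ∀ {r j c₀ c₁ p₀ p₁} a b → c₀ < r → c₁ < r → InRange r j a → InRange r j b →
  Admissible j c₀ a → Admissible j c₁ b →
  Link r (c₀ , p₀) (c₁ , p₁) a b ⇔ rank j c₀ a + 𝟙 ((c₁ , p₁) <ℓ? (c₀ , p₀)) ≤ rank j c₁ b
link⇔rank {r} {j} {c₀} {c₁} {p₀} {p₁} (k , x) (k' , x') c₀<r c₁<r (k<r , x≤j) (_ , x'≤j) adm₀ adm₁
  with <-cmp k k'
... | tri< k<k' _ _ = mk⇔ (λ _ → below) (λ _ → inj₁ (inj₁ k<k') , λ _ _ → inj₁ k<k')
  where
  below : rank j c₀ (k , x) + 𝟙 ((c₁ , p₁) <ℓ? (c₀ , p₀)) ≤ rank j c₁ (k' , x')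
  below = +𝟙≤ ((c₁ , p₁) <ℓ? (c₀ , p₀))
    (λ d → rank-mono-strict k<k' adm₀ x≤j (colour-split k<k' (≤ℓ⇒colour≤ (inj₁ d))))
    (λ _ → rank-mono k<k' adm₀ x≤j)
... | tri> _ _ k'<k = mk⇔ (λ (a≤b , _) → ⊥-elim (<⇒≱ k'<k (≤ℓ⇒colour≤ a≤b))) (λ le → ⊥-elim (<⇒≱ above le))
  where
  above : rank j c₁ (k' , x') < rank j c₀ (k , x) + 𝟙 ((c₁ , p₁) <ℓ? (c₀ , p₀))
  above = <+𝟙 ((c₁ , p₁) <ℓ? (c₀ , p₀))
    (λ _ → rank-mono k'<k adm₁ x'≤j)
    (λ ¬d → rank-mono-strict k'<k adm₁ x'≤j (colour-split k'<k (≮⇒≥ (¬d ∘ inj₁))))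
... | tri≈ _ refl _ = ranks⇔ ⇔-∘ sameBlock-link⇔
  where
  R = 𝟙 (recolor r (c₁ , p₁) k <ℓ? recolor r (c₀ , p₀) k)
  D = 𝟙 ((c₁ , p₁) <ℓ? (c₀ , p₀))
  b₀ = 𝟙 (c₀ <? k)
  b₁ = 𝟙 (c₁ <? k)
  shuffle₁ : ∀ a b x d → a + b + x + d ≡ a + x + (b + d)
  shuffle₁ = solve-∀
  shuffle₂ : ∀ a x R b → a + x + (R + b) ≡ a + b + (x + R)
  shuffle₂ = solve-∀
  rank₀+D : rank j c₀ (k , x) + D ≡ k * j + b₁ + (x + R)
  rank₀+D = begin
    k * j + b₀ + x + D    ≡⟨ shuffle₁ (k * j) b₀ x D ⟩
    k * j + x + (b₀ + D)  ≡⟨ cong (k * j + x +_) (recolor-descent p₀ p₁ k<r c₀<r c₁<r) ⟨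
    k * j + x + (R + b₁)  ≡⟨ shuffle₂ (k * j) x R b₁ ⟩
    k * j + b₁ + (x + R)  ∎
    where open ≡-Reasoning
  ranks⇔ : x + R ≤ x' ⇔ rank j c₀ (k , x) + D ≤ rank j c₁ (k , x')
  ranks⇔ = mk⇔ (λ le → subst (_≤ rank j c₁ (k , x')) (sym rank₀+D) (+-monoʳ-≤ (k * j + b₁) le))
               (λ le → +-cancelˡ-≤ (k * j + b₁) _ _ (subst (_≤ rank j c₁ (k , x')) rank₀+D le))

-- Colored partitions of a chain

IsChainPartition : ℕ → ℕ → ∀ {m} → (Fin m → Col) → (Fin m → Col) → Set
IsChainPartition r j π g =
  (∀ a b → toℕ a < toℕ b → g a ≤ℓ g b) ×
  (∀ a b → toℕ a < toℕ b → ε (g a) ≡ ε (g b) →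
     recolor r (π b) (ε (g a)) <ℓ recolor r (π a) (ε (g a)) → g a <ℓ g b) ×
  (∀ a → Admissible j (ε (π a)) (g a))

isChainPartition? : ∀ r j {m} (π g : Fin m → Col) → Dec (IsChainPartition r j π g)
isChainPartition? r j π g =
  all? (λ a → all? (λ b → (toℕ a <? toℕ b) →-dec (g a ≤ℓ? g b))) ×-dec
  all? (λ a → all? (λ b → (toℕ a <? toℕ b) →-dec ((ε (g a) ≟ ε (g b)) →-dec
     ((recolor r (π b) (ε (g a)) <ℓ? recolor r (π a) (ε (g a))) →-dec (g a <ℓ? g b))))) ×-dec
  all? (λ a → admissible? j (ε (π a)) (g a))

chainPartition-singleton⇔ : ∀ {r j} (π g : Fin 1 → Col) →
  IsChainPartition r j π g ⇔ Admissible j (ε (π F.zero)) (g F.zero)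
chainPartition-singleton⇔ π g = mk⇔ (λ (_ , _ , adm) → adm F.zero)
  (λ adm → (λ { F.zero F.zero () }) , (λ { F.zero F.zero () }) , λ { F.zero → adm })

chainPartition-cons : ∀ {r j m} (π : Fin (suc (suc m)) → Col) (a : Col) (h : Fin (suc m) → Col) →
  Admissible j (ε (π F.zero)) a → Link r (π F.zero) (π (F.suc F.zero)) a (h F.zero) →
  IsChainPartition r j (π ∘ F.suc) h → IsChainPartition r j π (consF a h)
chainPartition-cons {r} {j} π a h adm₀ (a≤h₀ , link) (mono , strict , adm) = mono′ , strict′ , adm′
  where
  h₀≤ : ∀ b → h F.zero ≤ℓ h b
  h₀≤ F.zero = inj₂ refl
  h₀≤ (F.suc b) = mono F.zero (F.suc b) z<s
  mono′ : ∀ x y → toℕ x < toℕ y → consF a h x ≤ℓ consF a h y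
  mono′ F.zero (F.suc y) _ = ≤ℓ-trans a≤h₀ (h₀≤ y)
  mono′ (F.suc x) (F.suc y) (s<s x<y) = mono x y x<y
  -- If a = h 0 = h (b + 1), the two links force the recoloured labels of π 0, π 1 and
  -- π (b + 2) to increase weakly, contradicting R.
  strict′ : ∀ x y → toℕ x < toℕ y → ε (consF a h x) ≡ ε (consF a h y) →
    recolor r (π y) (ε (consF a h x)) <ℓ recolor r (π x) (ε (consF a h x)) → consF a h x <ℓ consF a h y
  strict′ F.zero (F.suc F.zero) _ = link
  strict′ F.zero (F.suc (F.suc b)) _ _ R with a <ℓ? h (F.suc b)
  ... | yes a<hb = a<hb
  ... | no a≮hb = ⊥-elim (collapse a≡h₀ (trans (sym a≡h₀) a≡hb))
    where
    a≡hb : a ≡ h (F.suc b)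
    a≡hb = ≤ℓ-antisym (≤ℓ-trans a≤h₀ (h₀≤ (F.suc b))) (≮ℓ⇒≥ _ _ a≮hb)
    a≡h₀ : a ≡ h F.zero
    a≡h₀ = ≤ℓ-antisym a≤h₀ (subst (h F.zero ≤ℓ_) (sym a≡hb) (h₀≤ (F.suc b)))
    collapse : a ≡ h F.zero → h F.zero ≡ h (F.suc b) → ⊥
    collapse refl h₀≡hb = <ℓ-irrefl (≤<ℓ-trans (≤ℓ-trans rec₀≤rec₁ rec₁≤rec-b) R)
      where
      rec₀≤rec₁ : recolor r (π F.zero) (ε a) ≤ℓ recolor r (π (F.suc F.zero)) (ε a)
      rec₀≤rec₁ = ≮ℓ⇒≥ _ _ (λ lt → <ℓ-irrefl (link refl lt))
      rec₁≤rec-b : recolor r (π (F.suc F.zero)) (ε a) ≤ℓ recolor r (π (F.suc (F.suc b))) (ε a)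
      rec₁≤rec-b = ≮ℓ⇒≥ _ _ (λ lt → <ℓ-irrefl
        (subst (h F.zero <ℓ_) (sym h₀≡hb) (strict F.zero (F.suc b) z<s (cong ε h₀≡hb) lt)))
  strict′ (F.suc x) (F.suc y) (s<s x<y) = strict x y x<y
  adm′ : ∀ x → Admissible j (ε (π x)) (consF a h x)
  adm′ F.zero = adm₀
  adm′ (F.suc x) = adm x

chainPartition-cons⇔ : ∀ {r j m} (π : Fin (suc (suc m)) → Col) (a : Col) (h : Fin (suc m) → Col) →
  IsChainPartition r j π (consF a h) ⇔
  (Admissible j (ε (π F.zero)) a × Link r (π F.zero) (π (F.suc F.zero)) a (h F.zero) ×
   IsChainPartition r j (π ∘ F.suc) h)
chainPartition-cons⇔ π a h = mk⇔
  (λ (mono , strict , adm) →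
    adm F.zero , (mono F.zero (F.suc F.zero) z<s , strict F.zero (F.suc F.zero) z<s) ,
    (λ x y → mono (F.suc x) (F.suc y) ∘ s<s) , (λ x y → strict (F.suc x) (F.suc y) ∘ s<s) , adm ∘ F.suc)
  (λ (adm₀ , link , chain) → chainPartition-cons π a h adm₀ link chain)

chainPartitionsFrom : ∀ r j {m} → (Fin (suc m) → Col) → ℕ → ℕ
chainPartitionsFrom r j {m} π t =
  ∑→ (Xr r j) (suc m) (λ g → 𝟙 (t ≤? rank j (ε (π F.zero)) (g F.zero)) * 𝟙 (isChainPartition? r j π g))

intdes≤ : ∀ m (π : Fin (suc m) → Col) → intdes π ≤ m
intdes≤ zero π = z≤n
intdes≤ (suc m) π = +-mono-≤ (𝟙≤1 (π (F.suc F.zero) <ℓ? π F.zero)) (intdes≤ m (π ∘ F.suc))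

rank≤r*j : ∀ {r j c} y → InRange r j y → Admissible j c y → rank j c y ≤ r * j
rank≤r*j {j = j} (k , x) (k<r , x≤j) adm = ≤-trans (rank≤ adm x≤j) (*-monoˡ-≤ j k<r)

tail-exponent : ∀ {N u δ m d} → u < N → δ ≤ 1 → d ≤ m →
  (N ∸ (u + δ)) + m ∸ d ≡ (N ∸ suc u) + ((suc m ∸ δ) ∸ d)
tail-exponent {N} {u} {zero} {m} {d} u<N _ d≤m = begin
  (N ∸ (u + 0)) + m ∸ d      ≡⟨ cong (λ z → (N ∸ z) + m ∸ d) (+-identityʳ u) ⟩
  (N ∸ u) + m ∸ d            ≡⟨ cong (λ z → z + m ∸ d) (+-∸-assoc 1 u<N) ⟩
  suc (N ∸ suc u) + m ∸ d    ≡⟨ cong (_∸ d) (+-suc (N ∸ suc u) m) ⟨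
  (N ∸ suc u) + suc m ∸ d    ≡⟨ +-∸-assoc (N ∸ suc u) (≤-trans d≤m (n≤1+n m)) ⟩
  (N ∸ suc u) + (suc m ∸ d)  ∎
  where open ≡-Reasoning
tail-exponent {N} {u} {suc zero} {m} {d} _ _ d≤m = begin
  (N ∸ (u + 1)) + m ∸ d      ≡⟨ cong (λ z → (N ∸ z) + m ∸ d) (+-comm u 1) ⟩
  (N ∸ suc u) + m ∸ d        ≡⟨ +-∸-assoc (N ∸ suc u) d≤m ⟩
  (N ∸ suc u) + (m ∸ d)      ∎
  where open ≡-Reasoning
tail-exponent {δ = suc (suc _)} _ (s≤s ()) _

head-exponent : ∀ X m δ d → δ + d ≤ suc m → X + suc m ∸ (δ + d) ≡ X + ((suc m ∸ δ) ∸ d)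
head-exponent X m δ d δ+d≤ = trans (+-∸-assoc X δ+d≤) (cong (X +_) (sym (∸-+-assoc (suc m) δ d)))

chainWeight-cons : ∀ {r j m} t (π : Fin (suc (suc m)) → Col) → (∀ i → ε (π i) < r) →
  ∀ a h → InRange r j a → (∀ i → InRange r j (h i)) →
  let c₀ = ε (π F.zero)
      r₀ = rank j c₀ a
      δ = 𝟙 (π (F.suc F.zero) <ℓ? π F.zero)
  in 𝟙 (t ≤? r₀) * 𝟙 (isChainPartition? r j π (consF a h))
       ≡ 𝟙 (admissible? j c₀ a) * (𝟙 (t ≤? r₀) *
           (𝟙 (r₀ + δ ≤? rank j (ε (π (F.suc F.zero))) (h F.zero)) * 𝟙 (isChainPartition? r j (π ∘ F.suc) h)))
chainWeight-cons {r} {j} t π colours a h a∈ h∈ = begin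
  B * 𝟙 (isChainPartition? r j π (consF a h))
    ≡⟨ cong (B *_) (𝟙-⇔ (isChainPartition? r j π (consF a h)) (A? ×-dec (L? ×-dec V?)) (chainPartition-cons⇔ π a h)) ⟩
  B * 𝟙 (A? ×-dec (L? ×-dec V?))
    ≡⟨ cong (B *_) (trans (𝟙-× A? (L? ×-dec V?)) (cong (𝟙 A? *_) (𝟙-× L? V?))) ⟩
  B * (𝟙 A? * (𝟙 L? * 𝟙 V?))
    ≡⟨ left-comm B (𝟙 A?) _ ⟩
  𝟙 A? * (B * (𝟙 L? * 𝟙 V?))
    ≡⟨ 𝟙-*-congˡ A? (λ adm → cong (B *_) (𝟙-*-congʳ V? (λ (_ , _ , adms) → 𝟙-⇔ L? R?
         (link⇔rank a (h F.zero) (colours F.zero) (colours (F.suc F.zero)) a∈ (h∈ F.zero) adm (adms F.zero))))) ⟩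
  𝟙 A? * (B * (𝟙 R? * 𝟙 V?)) ∎
  where
  open ≡-Reasoning
  B = 𝟙 (t ≤? rank j (ε (π F.zero)) a)
  A? = admissible? j (ε (π F.zero)) a
  L? = link? r (π F.zero) (π (F.suc F.zero)) a (h F.zero)
  V? = isChainPartition? r j (π ∘ F.suc) h
  R? = rank j (ε (π F.zero)) a + 𝟙 (π (F.suc F.zero) <ℓ? π F.zero) ≤? rank j (ε (π (F.suc F.zero))) (h F.zero)
  left-comm : ∀ x y z → x * (y * z) ≡ y * (x * z)
  left-comm = solve-∀

chainPartitionsFrom≡binomial : ∀ r j m (π : Fin (suc m) → Col) → (∀ i → ε (π i) < r) →
  ∀ t → t ≤ r * j + 1 → chainPartitionsFrom r j π t ≡ ((r * j + 1 ∸ t) + m ∸ intdes π) C suc m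
chainPartitionsFrom≡binomial r j zero π colours t t≤N = begin
  chainPartitionsFrom r j π t                               ≡⟨ ∑→-suc X 0 _ ⟩
  ∑ X (λ a → W a + 0)                                       ≡⟨ ∑-cong (All.universal single X) ⟩
  ∑ X (λ a → 𝟙 (admissible? j c a) * G (rank j c a))        ≡⟨ ∑-rank r j c G (colours F.zero) ⟩
  ∑< N G                                                    ≡⟨ hockey-stick N t 0 0 z≤n t≤N ⟩
  ((N ∸ t) + 0) C 1                                         ∎
  where
  open ≡-Reasoning
  X = Xr r j
  N = r * j + 1
  c = ε (π F.zero)
  G : ℕ → ℕ
  G u = 𝟙 (t ≤? u) * (((N ∸ suc u) + 0) C 0)
  W : Col → ℕ
  W a = 𝟙 (t ≤? rank j c a) * 𝟙 (isChainPartition? r j π (consF a (λ ())))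
  single : ∀ a → W a + 0 ≡ 𝟙 (admissible? j c a) * G (rank j c a)
  single a = begin
    W a + 0                                        ≡⟨ +-identityʳ _ ⟩
    𝟙 (t ≤? rank j c a) * 𝟙 (isChainPartition? r j π (consF a (λ ())))
      ≡⟨ cong (𝟙 (t ≤? rank j c a) *_) (𝟙-⇔ (isChainPartition? r j π (consF a (λ ()))) (admissible? j c a) (chainPartition-singleton⇔ π (consF a (λ ())))) ⟩
    𝟙 (t ≤? rank j c a) * 𝟙 (admissible? j c a)    ≡⟨ *-comm _ (𝟙 (admissible? j c a)) ⟩
    𝟙 (admissible? j c a) * 𝟙 (t ≤? rank j c a)    ≡⟨ cong (𝟙 (admissible? j c a) *_) (*-identityʳ _) ⟨
    𝟙 (admissible? j c a) * G (rank j c a)         ∎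
chainPartitionsFrom≡binomial r j (suc m) π colours t t≤N = begin
  chainPartitionsFrom r j π t
    ≡⟨ ∑→-suc X (suc m) _ ⟩
  ∑ X (λ a → ∑→ X (suc m) (λ h → W (consF a h)))
    ≡⟨ ∑-cong (All.map summed-over-tails (Xr-inRange r j)) ⟩
  ∑ X (λ a → 𝟙 (admissible? j c₀ a) * G (rank j c₀ a))
    ≡⟨ ∑-rank r j c₀ G (colours F.zero) ⟩
  ∑< N G
    ≡⟨ ∑<-cong N (λ u u<N → cong (λ z → 𝟙 (t ≤? u) * (z C suc m)) (tail-exponent u<N (𝟙≤1 D?) (intdes≤ m π'))) ⟩
  ∑< N (λ u → 𝟙 (t ≤? u) * (((N ∸ suc u) + e) C suc m))
    ≡⟨ hockey-stick N t e (suc m) (≤-trans (m∸n≤m _ d) (m∸n≤m (suc m) δ)) t≤N ⟩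
  ((N ∸ t) + e) C suc (suc m)
    ≡⟨ cong (_C suc (suc m)) (head-exponent (N ∸ t) m δ d (+-mono-≤ (𝟙≤1 D?) (intdes≤ m π'))) ⟨
  ((N ∸ t) + suc m ∸ intdes π) C suc (suc m) ∎
  where
  open ≡-Reasoning
  X = Xr r j
  N = r * j + 1
  π' = π ∘ F.suc
  c₀ = ε (π F.zero)
  D? = π (F.suc F.zero) <ℓ? π F.zero
  δ = 𝟙 D?
  d = intdes π'
  e = (suc m ∸ δ) ∸ d
  W : (Fin (suc (suc m)) → Col) → ℕ
  W g = 𝟙 (t ≤? rank j c₀ (g F.zero)) * 𝟙 (isChainPartition? r j π g)
  G : ℕ → ℕ
  G u = 𝟙 (t ≤? u) * (((N ∸ (u + δ)) + m ∸ d) C suc m)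
  summed-over-tails : ∀ {a} → InRange r j a →
    ∑→ X (suc m) (λ h → W (consF a h)) ≡ 𝟙 (admissible? j c₀ a) * G (rank j c₀ a)
  summed-over-tails {a} a∈ = begin
    ∑→ X (suc m) (λ h → W (consF a h))
      ≡⟨ ∑→-cong (Xr-inRange r j) (suc m) (λ h h∈ → chainWeight-cons t π colours a h a∈ h∈) ⟩
    ∑→ X (suc m) (λ h → A * (B * V h))
      ≡⟨ trans (∑-*ˡ A (allFuns X (suc m)) (λ h → B * V h)) (cong (A *_) (∑-*ˡ B (allFuns X (suc m)) V)) ⟩
    A * (B * chainPartitionsFrom r j π' (rank j c₀ a + δ))
      ≡⟨ 𝟙-*-congˡ (admissible? j c₀ a) (λ adm → cong (B *_) (chainPartitionsFrom≡binomial r j m π' (colours ∘ F.suc)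
           (rank j c₀ a + δ) (+-mono-≤ (rank≤r*j a a∈ adm) (𝟙≤1 D?)))) ⟩
    A * G (rank j c₀ a) ∎
    where
    A = 𝟙 (admissible? j c₀ a)
    B = 𝟙 (t ≤? rank j c₀ a)
    V : (Fin (suc m) → Col) → ℕ
    V h = 𝟙 (rank j c₀ a + δ ≤? rank j (ε (π' F.zero)) (h F.zero)) * 𝟙 (isChainPartition? r j π' h)

-- The poset P(π)

FixesZeros : ∀ n q → ℕ → (Fin (q + n) → Col) → Set
FixesZeros n q s f = ∀ (a : Fin q) → f (a ↑ˡ n) ≡ (s + toℕ a , 0)

fixesZeros? : ∀ n q s f → Dec (FixesZeros n q s f)
fixesZeros? n q s f = all? (λ a → f (a ↑ˡ n) ≡c? (s + toℕ a , 0))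

fixesZeros-cons⇔ : ∀ n q s b (g : Fin (q + n) → Col) →
  FixesZeros n (suc q) s (consF b g) ⇔ (b ≡ (s , 0) × FixesZeros n q (suc s) g)
fixesZeros-cons⇔ n q s b g = mk⇔
  (λ fz → trans (fz F.zero) (cong (_, 0) (+-identityʳ s)) , λ a → trans (fz (F.suc a)) (cong (_, 0) (+-suc s (toℕ a))))
  (λ { (b≡ , fz) F.zero → trans b≡ (cong (_, 0) (sym (+-identityʳ s)))
     ; (b≡ , fz) (F.suc a) → trans (fz a) (cong (_, 0) (sym (+-suc s (toℕ a)))) })

∑→-fixesZeros : ∀ r j n q s → s + q ≤ r → (V : (Fin n → Col) → ℕ) →
  ∑→ (Xr r j) (q + n) (λ f → 𝟙 (fixesZeros? n q s f) * V (λ i → f (q ↑ʳ i))) ≡ ∑→ (Xr r j) n V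
∑→-fixesZeros r j n zero s _ V = ∑→-cong (Xr-inRange r j) n (λ f _ → +-identityʳ (V f))
∑→-fixesZeros r j n (suc q) s s+q<r V = begin
  ∑→ X (suc q + n) (λ f → 𝟙 (fixesZeros? n (suc q) s f) * V (λ i → f (suc q ↑ʳ i)))
    ≡⟨ ∑→-suc X (q + n) _ ⟩
  ∑ X (λ b → ∑→ X (q + n) (λ g → 𝟙 (fixesZeros? n (suc q) s (consF b g)) * V (λ i → g (q ↑ʳ i))))
    ≡⟨ ∑-cong (All.universal first-fixed X) ⟩
  ∑ X (λ b → 𝟙 (b ≡c? (s , 0)) * ∑→ X n V)
    ≡⟨ ∑-Xr-δ r j s _ (<-≤-trans (m<m+n s z<s) s+q<r) ⟩
  ∑→ X n V ∎
  where
  open ≡-Reasoning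
  X = Xr r j
  first-fixed : ∀ b → ∑→ X (q + n) (λ g → 𝟙 (fixesZeros? n (suc q) s (consF b g)) * V (λ i → g (q ↑ʳ i)))
                        ≡ 𝟙 (b ≡c? (s , 0)) * ∑→ X n V
  first-fixed b = begin
    ∑→ X (q + n) (λ g → 𝟙 (fixesZeros? n (suc q) s (consF b g)) * V (λ i → g (q ↑ʳ i)))
      ≡⟨ ∑→-cong (Xr-inRange r j) (q + n) (λ g _ → split g) ⟩
    ∑→ X (q + n) (λ g → B * (𝟙 (fixesZeros? n q (suc s) g) * V (λ i → g (q ↑ʳ i))))
      ≡⟨ ∑-*ˡ B (allFuns X (q + n)) _ ⟩
    B * ∑→ X (q + n) (λ g → 𝟙 (fixesZeros? n q (suc s) g) * V (λ i → g (q ↑ʳ i)))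
      ≡⟨ cong (B *_) (∑→-fixesZeros r j n q (suc s) (subst (_≤ r) (+-suc s q) s+q<r) V) ⟩
    B * ∑→ X n V ∎
    where
    B = 𝟙 (b ≡c? (s , 0))
    split : ∀ g → 𝟙 (fixesZeros? n (suc q) s (consF b g)) * V (λ i → g (q ↑ʳ i))
                  ≡ B * (𝟙 (fixesZeros? n q (suc s) g) * V (λ i → g (q ↑ʳ i)))
    split g = trans (cong (_* V (λ i → g (q ↑ʳ i)))
                      (trans (𝟙-⇔ (fixesZeros? n (suc q) s (consF b g)) (b ≡c? (s , 0) ×-dec fixesZeros? n q (suc s) g) (fixesZeros-cons⇔ n q s b g))
                             (𝟙-× (b ≡c? (s , 0)) (fixesZeros? n q (suc s) g))))
                    (*-assoc B _ _)

module _ {r n j : ℕ} {π : Fin n → Col} (labels-nonzero : ∀ i → 1 ≤ ∣ π i ∣c) where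
  private
    p = r ∸ 1
    open CPoset (Pπ r n π)

    data View : Fin (p + n) → Set where
      zeroChain : (a : Fin p) → View (a ↑ˡ n)
      πChain : (i : Fin n) → View (p ↑ʳ i)

    view : ∀ x → View x
    view x with splitAt p x in eq
    ... | inj₁ a = subst View (splitAt⁻¹-↑ˡ eq) (zeroChain a)
    ... | inj₂ i = subst View (splitAt⁻¹-↑ʳ eq) (πChain i)

    lab-zero : ∀ a → lab (a ↑ˡ n) ≡ (suc (toℕ a) , 0)
    lab-zero a rewrite splitAt-↑ˡ p a n = refl

    lab-π : ∀ i → lab (p ↑ʳ i) ≡ π i
    lab-π i rewrite splitAt-↑ʳ p n i = refl

    ≺-zero⇔ : ∀ a b → (a ↑ˡ n) ≺ (b ↑ˡ n) ⇔ toℕ a < toℕ b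
    ≺-zero⇔ a b rewrite splitAt-↑ˡ p a n | splitAt-↑ˡ p b n = mk⇔ id id

    ≺-π⇔ : ∀ a b → (p ↑ʳ a) ≺ (p ↑ʳ b) ⇔ toℕ a < toℕ b
    ≺-π⇔ a b rewrite splitAt-↑ʳ p n a | splitAt-↑ʳ p n b = mk⇔ id id

    ¬≺-zero-π : ∀ a b → ¬ ((a ↑ˡ n) ≺ (p ↑ʳ b))
    ¬≺-zero-π a b rewrite splitAt-↑ˡ p a n | splitAt-↑ʳ p n b = λ ()

    ¬≺-π-zero : ∀ a b → ¬ ((p ↑ʳ a) ≺ (b ↑ˡ n))
    ¬≺-π-zero a b rewrite splitAt-↑ˡ p b n | splitAt-↑ʳ p n a = λ ()

  isPPartition-restrict : ∀ f → IsPPartition r (Pπ r n π) j f → FixesZeros n p 1 f × IsChainPartition r j π (λ i → f (p ↑ʳ i))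
  isPPartition-restrict f (fix , mono , strict , top) =
    (λ a → trans (fix (a ↑ˡ n) (cong proj₂ (lab-zero a))) (lab-zero a)) ,
    (λ a b → mono _ _ ∘ Equivalence.from (≺-π⇔ a b)) ,
    (λ a b a<b same R → strict _ _ (Equivalence.from (≺-π⇔ a b) a<b) same
       (subst₂ (λ u v → recolor r u (ε (f (p ↑ʳ a))) <ℓ recolor r v (ε (f (p ↑ʳ a)))) (sym (lab-π b)) (sym (lab-π a)) R)) ,
    (λ a → trans (cong ε (sym (lab-π a))) ∘ top _)

  isPPartition-extend : ∀ f → FixesZeros n p 1 f × IsChainPartition r j π (λ i → f (p ↑ʳ i)) → IsPPartition r (Pπ r n π) j f
  isPPartition-extend f (fz , mono , strict , adm) = fix , mono′ , strict′ , top
    where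
    fix : ∀ x → ∣ lab x ∣c ≡ 0 → f x ≡ lab x
    fix x lab≡0 with view x
    ... | zeroChain a = trans (fz a) (sym (lab-zero a))
    ... | πChain i = ⊥-elim (<-irrefl (sym (trans (cong proj₂ (sym (lab-π i))) lab≡0)) (labels-nonzero i))
    mono′ : ∀ x y → x ≺ y → f x ≤ℓ f y
    mono′ x y x≺y with view x | view y
    ... | zeroChain a | zeroChain b =
      subst₂ _≤ℓ_ (sym (fz a)) (sym (fz b)) (inj₁ (inj₁ (s<s (Equivalence.to (≺-zero⇔ a b) x≺y))))
    ... | zeroChain a | πChain b = ⊥-elim (¬≺-zero-π a b x≺y)
    ... | πChain a | zeroChain b = ⊥-elim (¬≺-π-zero a b x≺y)
    ... | πChain a | πChain b = mono a b (Equivalence.to (≺-π⇔ a b) x≺y)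
    strict′ : ∀ x y → x ≺ y → ε (f x) ≡ ε (f y) →
      recolor r (lab y) (ε (f x)) <ℓ recolor r (lab x) (ε (f x)) → f x <ℓ f y
    strict′ x y x≺y same R with view x | view y
    ... | zeroChain a | zeroChain b = ⊥-elim (<-irrefl
      (suc-injective (trans (sym (cong ε (fz a))) (trans same (cong ε (fz b))))) (Equivalence.to (≺-zero⇔ a b) x≺y))
    ... | zeroChain a | πChain b = ⊥-elim (¬≺-zero-π a b x≺y)
    ... | πChain a | zeroChain b = ⊥-elim (¬≺-π-zero a b x≺y)
    ... | πChain a | πChain b = strict a b (Equivalence.to (≺-π⇔ a b) x≺y) same
      (subst₂ (λ u v → recolor r u (ε (f (p ↑ʳ a))) <ℓ recolor r v (ε (f (p ↑ʳ a)))) (lab-π b) (lab-π a) R)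
    top : ∀ x → ∣ f x ∣c ≡ j → ε (lab x) ≡ ε (f x)
    top x fx≡j with view x
    ... | zeroChain a = trans (cong ε (lab-zero a)) (sym (cong ε (fz a)))
    ... | πChain i = trans (cong ε (lab-π i)) (adm i fx≡j)

  isPPartition⇔ : ∀ f → IsPPartition r (Pπ r n π) j f ⇔
    (FixesZeros n p 1 f × IsChainPartition r j π (λ i → f (p ↑ʳ i)))
  isPPartition⇔ f = mk⇔ (isPPartition-restrict f) (isPPartition-extend f)

mainTheorem7 : (r n : ℕ) → 1 ≤ r → 1 ≤ n → (π : Fin n → Col) → IsColoredPerm r n π →
    (j : ℕ) → Ω r (Pπ r n π) j ≡ ((r * j + n) ∸ intdes π) C n
mainTheorem7 r n@(suc m) 1≤r _ π (colours , bounds , _) j = begin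
  Ω r (Pπ r n π) j
    ≡⟨ length-filter≡∑𝟙 (isPPartition? r (Pπ r n π) j) (allFuns X (p + n)) ⟩
  ∑→ X (p + n) (λ f → 𝟙 (isPPartition? r (Pπ r n π) j f))
    ≡⟨ ∑→-cong (Xr-inRange r j) (p + n) (λ f _ → trans
         (𝟙-⇔ (isPPartition? r (Pπ r n π) j f) (fixesZeros? n p 1 f ×-dec chain? f) (isPPartition⇔ (proj₁ ∘ bounds) f))
         (𝟙-× (fixesZeros? n p 1 f) (chain? f))) ⟩
  ∑→ X (p + n) (λ f → 𝟙 (fixesZeros? n p 1 f) * 𝟙 (chain? f))
    ≡⟨ ∑→-fixesZeros r j n p 1 (≤-reflexive (m+[n∸m]≡n 1≤r)) (λ g → 𝟙 (isChainPartition? r j π g)) ⟩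
  ∑→ X n (λ g → 𝟙 (isChainPartition? r j π g))
    ≡⟨ ∑→-cong (Xr-inRange r j) n (λ g _ → sym (*-identityˡ _)) ⟩
  chainPartitionsFrom r j π 0
    ≡⟨ chainPartitionsFrom≡binomial r j m π colours 0 z≤n ⟩
  ((r * j + 1) + m ∸ intdes π) C n
    ≡⟨ cong (λ z → (z ∸ intdes π) C n) (+-assoc (r * j) 1 m) ⟩
  ((r * j + n) ∸ intdes π) C n ∎
  where
  open ≡-Reasoning
  p = r ∸ 1
  X = Xr r j
  chain? : (f : Fin (p + n) → Col) → Dec (IsChainPartition r j π (λ i → f (p ↑ʳ i)))
  chain? f = isChainPartition? r j π (λ i → f (p ↑ʳ i))
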